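{- Let $U$ be a set and $\lesssim$ a quasiorder on $U$, and let $\mathit{RS}=\{(X^{\blacktriangledown},X^{\blacktriangle})\mid X\subseteq U\}$ be ordered coordinatewise by inclusion, where $X^{\blacktriangle}=\{x\mid [x)\cap X\neq\emptyset\}$, $X^{\blacktriangledown}=\{x\mid [x)\subseteq X\}$ and $[x)=\{y\mid x\lesssim y\}$. Let $\Rightarrow^*$ be the relative pseudocomplement in $\langle\mathit{RS};\le\rangle$, ${\sim}(A,B)=(B^c,A^c)$, $a\to b:=a\Rightarrow^*({\sim}a\vee b)$, $a\Rightarrow b:=(a\to b)\wedge({\sim}b\to{\sim}a)$ and $a*b:={\sim}(a\to{\sim}b)\vee{\sim}(b\to{\sim}a)$, giving the residuated lattice $\langle\mathit{RS};\wedge,\vee,*,\Rightarrow,(\emptyset,\emptyset),(U,U)\rangle$. Then the Boolean elements of this residuated lattice, i.e. the elements $x$ with $x\vee(x\Rightarrow(\emptyset,\emptyset))=(U,U)$, are exactly the exact rough sets, i.e. the pairs $(A,B)\in\mathit{RS}$ with $A=B$.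
   Context: $\mathit{RS}$ is a complete sublattice of $\wp(U)\times\wp(U)$ with coordinatewise unions and intersections as joins and meets, hence a Heyting algebra; complements $X^c=U\setminus X$. -}

module Defs where

open import Level using (Level; 0ℓ; suc)
open import Data.Product using (Σ; ∃; ∃-syntax; _×_; _,_; proj₁; proj₂)
open import Data.Sum using (_⊎_)
open import Relation.Nullary using (¬_)
open import Relation.Unary using (Pred; _⊆_; _∪_; _∩_; ∅; U)
open import Relation.Binary using (Rel)

_≐_ : {A : Set} → Pred A 0ℓ → Pred A 0ℓ → Set
X ≐ Y = (X ⊆ Y) × (Y ⊆ X)

_ᶜ : {A : Set} → Pred A 0ℓ → Pred A 0ℓ
(X ᶜ) x = ¬ X x

module RoughSets {A : Set} (_≲_ : Rel A 0ℓ) where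

  ⟦_⟫ : A → Pred A 0ℓ
  ⟦ x ⟫ y = x ≲ y

  _▲ : Pred A 0ℓ → Pred A 0ℓ
  (X ▲) x = ∃[ y ] (⟦ x ⟫ y × X y)

  _▼ : Pred A 0ℓ → Pred A 0ℓ
  (X ▼) x = ⟦ x ⟫ ⊆ X

  Pair : Set₁
  Pair = Pred A 0ℓ × Pred A 0ℓ

  InRS : Pair → Set₁
  InRS (P , Q) = ∃[ X ] ((P ≐ (X ▼)) × (Q ≐ (X ▲)))

  _≤ₚ_ : Pair → Pair → Set
  (P , Q) ≤ₚ (P' , Q') = (P ⊆ P') × (Q ⊆ Q')

  _≈ₚ_ : Pair → Pair → Set
  (P , Q) ≈ₚ (P' , Q') = (P ≐ P') × (Q ≐ Q')

  _∧ₚ_ : Pair → Pair → Pair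
  (P , Q) ∧ₚ (P' , Q') = (P ∩ P') , (Q ∩ Q')

  _∨ₚ_ : Pair → Pair → Pair
  (P , Q) ∨ₚ (P' , Q') = (P ∪ P') , (Q ∪ Q')

  bot : Pair
  bot = ∅ , ∅

  top : Pair
  top = U , U

  ∼_ : Pair → Pair
  ∼ (P , Q) = (Q ᶜ) , (P ᶜ)

  IsRelPseudocomplement : (Pair → Pair → Pair) → Set₁
  IsRelPseudocomplement imp =
    (∀ a b → InRS a → InRS b → InRS (imp a b)) ×
    (∀ a b c → InRS a → InRS b → InRS c →
       ((c ≤ₚ imp a b) → ((a ∧ₚ c) ≤ₚ b)) × (((a ∧ₚ c) ≤ₚ b) → (c ≤ₚ imp a b)))

  module Ops (imp : Pair → Pair → Pair) where
    _⟶_ : Pair → Pair → Pair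
    a ⟶ b = imp a ((∼ a) ∨ₚ b)

    _⇒_ : Pair → Pair → Pair
    a ⇒ b = (a ⟶ b) ∧ₚ ((∼ b) ⟶ (∼ a))

    _⊛_ : Pair → Pair → Pair
    a ⊛ b = (∼ (a ⟶ (∼ b))) ∨ₚ (∼ (b ⟶ (∼ a)))

    IsBoolean : Pair → Set
    IsBoolean x = (x ∨ₚ (x ⇒ bot)) ≈ₚ top

  IsExact : Pair → Set
  IsExact (P , Q) = P ≐ Q

{-# OPTIONS --safe #-}
module Submission where

-- Since ∼0 is the top of RS, the second conjunct of x ⇒ 0 = (x ⇒* ∼x) ∧ (∼0 ⇒* (∼∼0 ∨ ∼x))
-- is ∼x, while the first lies above ∼x; hence x ⇒ 0 = ∼x. So (A, B) ∈ RS is Boolean iff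
-- (A, B) ∨ (Bᶜ, Aᶜ) = (U, U), i.e. iff B ⊆ A, and A ⊆ B holds anyway by reflexivity of ≲.

open import Defs
open import Level using (0ℓ; suc)
open import Axiom.ExcludedMiddle using (ExcludedMiddle)
open import Relation.Binary using (Rel; IsPreorder)
open import Relation.Binary.PropositionalEquality using (_≡_)
open import Data.Product using (_×_; _,_; proj₁; proj₂)
open import Data.Sum using (inj₁; inj₂; [_,_]; map₂)
open import Function using (id; _∘_)
open import Relation.Nullary.Decidable using (decidable-stable; toSum)
open import Relation.Unary using (_⊆_; ∅)
open import Relation.Nullary.Negation using (contradiction; contraposition)

module PairLattice {A : Set} (_≲_ : Rel A 0ℓ) where
  open RoughSets _≲_

  ≤ₚ-refl : ∀ {a} → a ≤ₚ a
  ≤ₚ-refl {_ , _} = id , id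

  ≤ₚ-trans : ∀ {a b c} → a ≤ₚ b → b ≤ₚ c → a ≤ₚ c
  ≤ₚ-trans {_ , _} {_ , _} {_ , _} (p , q) (p′ , q′) = p′ ∘ p , q′ ∘ q

  ≤ₚ-antisym : ∀ {a b} → a ≤ₚ b → b ≤ₚ a → a ≈ₚ b
  ≤ₚ-antisym {_ , _} {_ , _} (p , q) (p′ , q′) = (p , p′) , (q , q′)

  ≈ₚ-sym : ∀ {a b} → a ≈ₚ b → b ≈ₚ a
  ≈ₚ-sym {_ , _} {_ , _} ((p , p′) , (q , q′)) = (p′ , p) , (q′ , q)

  ≈ₚ-trans : ∀ {a b c} → a ≈ₚ b → b ≈ₚ c → a ≈ₚ c
  ≈ₚ-trans {_ , _} {_ , _} {_ , _} ((p , p′) , (q , q′)) ((r , r′) , (t , t′)) =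
    (r ∘ p , p′ ∘ r′) , (t ∘ q , q′ ∘ t′)

  ≈ₚ⇒≤ₚ : ∀ {a b} → a ≈ₚ b → a ≤ₚ b
  ≈ₚ⇒≤ₚ {_ , _} {_ , _} ((p , _) , (q , _)) = p , q

  ≈ₚ⇒≥ₚ : ∀ {a b} → a ≈ₚ b → b ≤ₚ a
  ≈ₚ⇒≥ₚ {_ , _} {_ , _} ((_ , p) , (_ , q)) = p , q

  bot-min : ∀ {a} → bot ≤ₚ a
  bot-min {_ , _} = (λ ()) , (λ ())

  top-max : ∀ {a} → a ≤ₚ top
  top-max {_ , _} = _ , _

  x∧y≤y : ∀ {a b} → (a ∧ₚ b) ≤ₚ b
  x∧y≤y {_ , _} {_ , _} = proj₂ , proj₂

  ∧-greatest : ∀ {a b c} → c ≤ₚ a → c ≤ₚ b → c ≤ₚ (a ∧ₚ b)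
  ∧-greatest {_ , _} {_ , _} {_ , _} (p , q) (p′ , q′) = (λ z → p z , p′ z) , (λ z → q z , q′ z)

  x≤x∨y : ∀ {a b} → a ≤ₚ (a ∨ₚ b)
  x≤x∨y {_ , _} {_ , _} = inj₁ , inj₁

  y≤x∨y : ∀ {a b} → b ≤ₚ (a ∨ₚ b)
  y≤x∨y {_ , _} {_ , _} = inj₂ , inj₂

  ∨-least : ∀ {a b c} → a ≤ₚ c → b ≤ₚ c → (a ∨ₚ b) ≤ₚ c
  ∨-least {_ , _} {_ , _} {_ , _} (p , q) (p′ , q′) = [ p , p′ ] , [ q , q′ ]

  ∨-monoʳ : ∀ {a b c} → b ≤ₚ c → (a ∨ₚ b) ≤ₚ (a ∨ₚ c)
  ∨-monoʳ b≤c = ∨-least x≤x∨y (≤ₚ-trans b≤c y≤x∨y)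

  ∨-identityʳ : ∀ {a} → (a ∨ₚ bot) ≈ₚ a
  ∨-identityʳ = ≤ₚ-antisym (∨-least ≤ₚ-refl bot-min) x≤x∨y

  ∼∼bot≤bot : (∼ ∼ bot) ≤ₚ bot
  ∼∼bot≤bot = (λ ¬¬⊥ → ¬¬⊥ λ ()) , (λ ¬¬⊥ → ¬¬⊥ λ ())

  top≤∼bot : top ≤ₚ (∼ bot)
  top≤∼bot = (λ _ ()) , (λ _ ())

  InRS-resp-≈ₚ : ∀ {a b} → a ≈ₚ b → InRS a → InRS b
  InRS-resp-≈ₚ {_ , _} {_ , _} ((p , p′) , (q , q′)) (X , (s , s′) , (t , t′)) =
    X , (s ∘ p′ , p ∘ s′) , (t ∘ q′ , q ∘ t′)

  complemented⇒exact : ∀ {P Q} → P ⊆ Q → top ≤ₚ ((P , Q) ∨ₚ (∼ (P , Q))) → IsExact (P , Q)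
  complemented⇒exact P⊆Q (P∪Qᶜ , _) = P⊆Q , λ Q → [ id , contradiction Q ] (P∪Qᶜ _)

  exact⇒complemented : ExcludedMiddle 0ℓ →
    ∀ {P Q} → IsExact (P , Q) → top ≤ₚ ((P , Q) ∨ₚ (∼ (P , Q)))
  exact⇒complemented em (P⊆Q , Q⊆P) =
    (λ _ → map₂ (contraposition Q⊆P) (toSum em)) , (λ _ → map₂ (contraposition P⊆Q) (toSum em))

module Approximations {A : Set} (_≲_ : Rel A 0ℓ) where
  open RoughSets _≲_

  ▲ᶜ⊆ᶜ▼ : ∀ X → ((X ▲) ᶜ) ⊆ ((X ᶜ) ▼)
  ▲ᶜ⊆ᶜ▼ X ¬X▲ x≲y Xy = ¬X▲ (_ , x≲y , Xy)

  ᶜ▼⊆▲ᶜ : ∀ X → ((X ᶜ) ▼) ⊆ ((X ▲) ᶜ)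
  ᶜ▼⊆▲ᶜ X ᶜ▼ (_ , x≲y , Xy) = ᶜ▼ x≲y Xy

  ᶜ▲⊆▼ᶜ : ∀ X → ((X ᶜ) ▲) ⊆ ((X ▼) ᶜ)
  ᶜ▲⊆▼ᶜ X (_ , x≲y , ¬Xy) X▼ = ¬Xy (X▼ x≲y)

  ▼ᶜ⊆ᶜ▲ : ExcludedMiddle 0ℓ → ∀ X → ((X ▼) ᶜ) ⊆ ((X ᶜ) ▲)
  ▼ᶜ⊆ᶜ▲ em X ¬X▼ = decidable-stable em λ ¬ᶜ▲ →
    ¬X▼ λ {y} x≲y → decidable-stable em λ ¬Xy → ¬ᶜ▲ (y , x≲y , ¬Xy)

  ∼-InRS : ExcludedMiddle 0ℓ → ∀ {a} → InRS a → InRS (∼ a)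
  ∼-InRS em {_ , _} (X , (p , p′) , (q , q′)) =
    X ᶜ , (▲ᶜ⊆ᶜ▼ X ∘ contraposition q′ , contraposition q ∘ ᶜ▼⊆▲ᶜ X)
        , (▼ᶜ⊆ᶜ▲ em X ∘ contraposition p′ , contraposition p ∘ ᶜ▲⊆▼ᶜ X)

  module _ (refl : ∀ {x} → x ≲ x) where

    ▼⊆▲ : ∀ X → (X ▼) ⊆ (X ▲)
    ▼⊆▲ X X▼ = _ , refl , X▼ refl

    InRS⇒lower⊆upper : ∀ {P Q} → InRS (P , Q) → P ⊆ Q
    InRS⇒lower⊆upper (X , (p , _) , (_ , q′)) P = q′ (▼⊆▲ X (p P))

    bot-InRS : InRS bot
    bot-InRS = ∅ , ((λ ()) , λ ∅▼ → ∅▼ refl) , ((λ ()) , λ ())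

module RelativePseudocomplement {A : Set} (_≲_ : Rel A 0ℓ)
  (imp : RoughSets.Pair _≲_ → RoughSets.Pair _≲_ → RoughSets.Pair _≲_)
  (isRPC : RoughSets.IsRelPseudocomplement _≲_ imp) where
  open RoughSets _≲_
  open PairLattice _≲_

  imp-InRS : ∀ {a b} → InRS a → InRS b → InRS (imp a b)
  imp-InRS = proj₁ isRPC _ _

  transpose-∧ : ∀ {a b c} → InRS a → InRS b → InRS c → c ≤ₚ imp a b → (a ∧ₚ c) ≤ₚ b
  transpose-∧ a b c = proj₁ (proj₂ isRPC _ _ _ a b c)

  transpose-imp : ∀ {a b c} → InRS a → InRS b → InRS c → (a ∧ₚ c) ≤ₚ b → c ≤ₚ imp a b
  transpose-imp a b c = proj₂ (proj₂ isRPC _ _ _ a b c)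

  imp-eval : ∀ {a b} → InRS a → InRS b → (a ∧ₚ imp a b) ≤ₚ b
  imp-eval a b = transpose-∧ a b (imp-InRS a b) ≤ₚ-refl

  ≤⇒≤imp : ∀ {a b c} → InRS a → InRS b → InRS c → c ≤ₚ b → c ≤ₚ imp a b
  ≤⇒≤imp a b c c≤b = transpose-imp a b c (≤ₚ-trans x∧y≤y c≤b)

  imp-topˡ : ∀ {a b} → InRS a → InRS b → top ≤ₚ a → imp a b ≈ₚ b
  imp-topˡ a b top≤a = ≤ₚ-antisym
    (≤ₚ-trans (∧-greatest (≤ₚ-trans top-max top≤a) ≤ₚ-refl) (imp-eval a b))
    (≤⇒≤imp a b b ≤ₚ-refl)

module BooleanElements (em : ExcludedMiddle 0ℓ) {A : Set} (_≲_ : Rel A 0ℓ) (refl : ∀ {x} → x ≲ x)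
  (imp : RoughSets.Pair _≲_ → RoughSets.Pair _≲_ → RoughSets.Pair _≲_)
  (isRPC : RoughSets.IsRelPseudocomplement _≲_ imp) where
  open RoughSets _≲_
  open Ops imp
  open PairLattice _≲_
  open Approximations _≲_
  open RelativePseudocomplement _≲_ imp isRPC

  ⇒bot≈∼ : ∀ {x} → InRS x → (x ⇒ bot) ≈ₚ (∼ x)
  ⇒bot≈∼ {x} xRS = ≤ₚ-antisym
    (≤ₚ-trans x∧y≤y (≈ₚ⇒≤ₚ ∼bot⟶∼x≈∼x))
    (∧-greatest ∼x≤x⟶bot (≈ₚ⇒≥ₚ ∼bot⟶∼x≈∼x))
    where
    ∼xRS : InRS (∼ x)
    ∼xRS = ∼-InRS em xRS

    ∼x≤x⟶bot : (∼ x) ≤ₚ (x ⟶ bot)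
    ∼x≤x⟶bot = ≤⇒≤imp xRS (InRS-resp-≈ₚ (≈ₚ-sym ∨-identityʳ) ∼xRS) ∼xRS x≤x∨y

    ∼∼bot∨∼x≈∼x : ((∼ ∼ bot) ∨ₚ (∼ x)) ≈ₚ (∼ x)
    ∼∼bot∨∼x≈∼x = ≤ₚ-antisym (∨-least (≤ₚ-trans ∼∼bot≤bot bot-min) ≤ₚ-refl) y≤x∨y

    ∼bot⟶∼x≈∼x : ((∼ bot) ⟶ (∼ x)) ≈ₚ (∼ x)
    ∼bot⟶∼x≈∼x = ≈ₚ-trans
      (imp-topˡ (∼-InRS em (bot-InRS refl)) (InRS-resp-≈ₚ (≈ₚ-sym ∼∼bot∨∼x≈∼x) ∼xRS) top≤∼bot)
      ∼∼bot∨∼x≈∼x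

  boolean⇒complemented : ∀ {x} → InRS x → IsBoolean x → top ≤ₚ (x ∨ₚ (∼ x))
  boolean⇒complemented xRS B = ≤ₚ-trans (≈ₚ⇒≥ₚ B) (∨-monoʳ (≈ₚ⇒≤ₚ (⇒bot≈∼ xRS)))

  complemented⇒boolean : ∀ {x} → InRS x → top ≤ₚ (x ∨ₚ (∼ x)) → IsBoolean x
  complemented⇒boolean xRS c = ≤ₚ-antisym top-max (≤ₚ-trans c (∨-monoʳ (≈ₚ⇒≥ₚ (⇒bot≈∼ xRS))))

proposition4p28 : ExcludedMiddle 0ℓ → ExcludedMiddle (suc 0ℓ) →
    (U : Set) (_≲_ : Rel U 0ℓ) → IsPreorder _≡_ _≲_ →
    (imp : RoughSets.Pair _≲_ → RoughSets.Pair _≲_ → RoughSets.Pair _≲_) →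
    RoughSets.IsRelPseudocomplement _≲_ imp →
    ∀ x → RoughSets.InRS _≲_ x →
    (RoughSets.Ops.IsBoolean _≲_ imp x → RoughSets.IsExact _≲_ x) ×
    (RoughSets.IsExact _≲_ x → RoughSets.Ops.IsBoolean _≲_ imp x)
proposition4p28 em _ _ _≲_ pre imp isRPC (_ , _) xRS =
  complemented⇒exact (InRS⇒lower⊆upper refl xRS) ∘ boolean⇒complemented xRS ,
  complemented⇒boolean xRS ∘ exact⇒complemented em
  where
  open IsPreorder pre using (refl)
  open PairLattice _≲_
  open Approximations _≲_
  open BooleanElements em _≲_ refl imp isRPC
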